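{- Let $G$ be a group regarded as a $G$-space under left multiplication, and let $A\subseteq G$. Then $A$ is doubly complemented if and only if $A$ is a homogeneous kaleidoscopical configuration.
   Context: A factorization $G=AB$ means the map $A\times B\to G$, $(a,b)\mapsto ab$, is bijective. $A\subseteq G$ is doubly complemented if there are subsets $B,C\subseteq G$ with factorizations $G=AB$ and $G=BC$. For $A\subseteq G$ put $G[A]=\{gA:g\in G\}$; a set $T\subseteq G$ is a $G[A]$-transversal if $|gA\cap T|=1$ for all $g\in G$. $A$ is a kaleidoscopical configuration if there is a map $\chi:G\to C$ to some set $C$ such that $\chi|_{gA}:gA\to C$ is bijective for every $g\in G$. A kaleidoscopical configuration $A$ is homogeneous if there exist a $G[A]$-transversal $T$ and a subset $H\subseteq G$ such that the sets $hT$, $h\in H$, are pairwise disjoint and their union is $G$. -}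

module Defs where

open import Level using (Level; _⊔_; suc)
open import Algebra.Bundles using (Group)
open import Data.Product using (Σ; ∃; ∃-syntax; _×_; _,_)
open import Relation.Unary using (Pred)
open import Relation.Binary.Bundles using (Setoid)
open import Function.Bundles using (Func)

module GroupNotions {c ℓ : Level} (G : Group c ℓ) where
  open Group G

  Respects≈ : {p : Level} → Pred Carrier p → Set (c ⊔ ℓ ⊔ p)
  Respects≈ A = ∀ {x y} → x ≈ y → A x → A y

  _·_ : {p : Level} → Carrier → Pred Carrier p → Pred Carrier (c ⊔ ℓ ⊔ p)
  (g · A) x = ∃[ a ] (A a × x ≈ g ∙ a)

  Factorization : {p q : Level} → Pred Carrier p → Pred Carrier q → Set (c ⊔ ℓ ⊔ p ⊔ q)
  Factorization A B =
    (∀ g → ∃[ a ] ∃[ b ] (A a × B b × a ∙ b ≈ g))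
    × (∀ {a a′ b b′} → A a → A a′ → B b → B b′ → a ∙ b ≈ a′ ∙ b′ → (a ≈ a′ × b ≈ b′))

  DoublyComplemented : {p : Level} → Pred Carrier p → Set (c ⊔ ℓ ⊔ suc p)
  DoublyComplemented {p} A =
    Σ (Pred Carrier p) λ B → Σ (Pred Carrier p) λ C →
      Respects≈ B × Respects≈ C × Factorization A B × Factorization B C

  Transversal : {p q : Level} → Pred Carrier p → Pred Carrier q → Set (c ⊔ ℓ ⊔ p ⊔ q)
  Transversal A T =
    ∀ g → (∃[ x ] ((g · A) x × T x))
          × (∀ {x y} → (g · A) x → T x → (g · A) y → T y → x ≈ y)

  Kaleidoscopical : {p : Level} → Pred Carrier p → Set (suc c ⊔ suc ℓ ⊔ p)
  Kaleidoscopical A =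
    Σ (Setoid c ℓ) λ C → let open Setoid C renaming (Carrier to Col; _≈_ to _≈C_) in
    Σ (Func setoid C) λ χ → let open Func χ renaming (to to χ′) in
      ∀ g → (∀ {x y} → (g · A) x → (g · A) y → χ′ x ≈C χ′ y → x ≈ y)
            × (∀ (k : Col) → ∃[ x ] ((g · A) x × χ′ x ≈C k))

  HomogeneousKaleidoscopical : {p : Level} → Pred Carrier p → Set (suc c ⊔ suc ℓ ⊔ suc p)
  HomogeneousKaleidoscopical {p} A =
    Kaleidoscopical A ×
    (Σ (Pred Carrier p) λ T → Σ (Pred Carrier p) λ H →
       Respects≈ T × Respects≈ H × Transversal A T
       × (∀ {h h′ x} → H h → H h′ → (h · T) x → (h′ · T) x → h ≈ h′)
       × (∀ g → ∃[ h ] (H h × (h · T) g)))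

-- Inverting every element turns a factorization G = X Y into G = Y⁻¹ X⁻¹.
-- With this, the data of a homogeneous kaleidoscopical configuration is a
-- disguised pair of factorizations: T is a G[A]-transversal iff G = A T⁻¹, and
-- the translates h T (h ∈ H) tile G iff G = H T.  So G = A B, G = B C
-- corresponds to T = B⁻¹, H = C⁻¹.  Kaleidoscopicity comes for free from
-- G = A B and G = H B⁻¹: colouring each element by its H-component is a
-- bijection on every translate g A.
module Submission where

open import Defs
open import Level using (Level; _⊔_)
open import Algebra.Bundles using (Group)
open import Relation.Unary using (Pred)
open import Function.Base using (id)
open import Function.Bundles using (_⇔_; mk⇔; Func)
open import Data.Product using (_×_; _,_; proj₁; proj₂; map; swap; ∃-syntax)
import Algebra.Properties.Group as GroupProperties
import Relation.Binary.Construct.On as On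
import Relation.Binary.Reasoning.Setoid as SetoidReasoning

module Factorizations {c ℓ : Level} (G : Group c ℓ) where
  open Group G
  open GroupProperties G
  open SetoidReasoning setoid
  open GroupNotions G

  _⁻¹ᵖ : {p : Level} → Pred Carrier p → Pred Carrier p
  (X ⁻¹ᵖ) x = X (x ⁻¹)

  Tiling : {p q : Level} → Pred Carrier p → Pred Carrier q → Set (c ⊔ ℓ ⊔ p ⊔ q)
  Tiling H T =
    (∀ {h h′ x} → H h → H h′ → (h · T) x → (h′ · T) x → h ≈ h′)
    × (∀ g → ∃[ h ] (H h × (h · T) g))

  ⁻¹ᵖ-respects : {p : Level} {X : Pred Carrier p} → Respects≈ X → Respects≈ (X ⁻¹ᵖ)
  ⁻¹ᵖ-respects respX x≈y = respX (⁻¹-cong x≈y)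

  x∈X⇒x⁻¹∈X⁻¹ : {p : Level} {X : Pred Carrier p} → Respects≈ X → ∀ {x} → X x → (X ⁻¹ᵖ) (x ⁻¹)
  x∈X⇒x⁻¹∈X⁻¹ respX {x} = respX (sym (⁻¹-involutive x))

  x≈g∙a⇒a∙x⁻¹≈g⁻¹ : ∀ {x g a} → x ≈ g ∙ a → a ∙ x ⁻¹ ≈ g ⁻¹
  x≈g∙a⇒a∙x⁻¹≈g⁻¹ {x} {g} {a} x≈ga = begin
    a ∙ x ⁻¹         ≈⟨ ∙-congˡ (⁻¹-cong x≈ga) ⟩
    a ∙ (g ∙ a) ⁻¹   ≈⟨ ∙-congˡ (⁻¹-anti-homo-∙ g a) ⟩
    a ∙ (a ⁻¹ ∙ g ⁻¹) ≈⟨ \\-leftDividesˡ a (g ⁻¹) ⟩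
    g ⁻¹             ∎

  a∙b≈g⁻¹⇒[g∙a]⁻¹≈b : ∀ {g a b} → a ∙ b ≈ g ⁻¹ → (g ∙ a) ⁻¹ ≈ b
  a∙b≈g⁻¹⇒[g∙a]⁻¹≈b {g} {a} {b} ab≈g⁻¹ = begin
    (g ∙ a) ⁻¹     ≈⟨ ⁻¹-anti-homo-∙ g a ⟩
    a ⁻¹ ∙ g ⁻¹    ≈⟨ ∙-congˡ ab≈g⁻¹ ⟨
    a ⁻¹ ∙ (a ∙ b) ≈⟨ \\-leftDividesʳ a b ⟩
    b              ∎

  g∙a≈h∙t⇒a∙t⁻¹≈g⁻¹∙h : ∀ {g a h t} → g ∙ a ≈ h ∙ t → a ∙ t ⁻¹ ≈ g ⁻¹ ∙ h
  g∙a≈h∙t⇒a∙t⁻¹≈g⁻¹∙h {g} {a} {h} {t} ga≈ht = begin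
    a ∙ t ⁻¹                  ≈⟨ ∙-congʳ (y≈x\\z g a (h ∙ t) ga≈ht) ⟩
    g ⁻¹ ∙ (h ∙ t) ∙ t ⁻¹     ≈⟨ ∙-congʳ (assoc (g ⁻¹) h t) ⟨
    g ⁻¹ ∙ h ∙ t ∙ t ⁻¹       ≈⟨ //-rightDividesʳ t (g ⁻¹ ∙ h) ⟩
    g ⁻¹ ∙ h                  ∎

  a∙b≈g⁻¹∙h⇒g∙a≈h∙b⁻¹ : ∀ {g a b h} → a ∙ b ≈ g ⁻¹ ∙ h → g ∙ a ≈ h ∙ b ⁻¹
  a∙b≈g⁻¹∙h⇒g∙a≈h∙b⁻¹ {g} {a} {b} {h} ab≈g⁻¹h = begin
    g ∙ a                ≈⟨ ∙-congˡ (x≈z//y a b (g ⁻¹ ∙ h) ab≈g⁻¹h) ⟩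
    g ∙ (g ⁻¹ ∙ h ∙ b ⁻¹) ≈⟨ assoc g (g ⁻¹ ∙ h) (b ⁻¹) ⟨
    g ∙ (g ⁻¹ ∙ h) ∙ b ⁻¹ ≈⟨ ∙-congʳ (\\-leftDividesˡ g h) ⟩
    h ∙ b ⁻¹             ∎

  b⁻¹≈[a∙b]⁻¹∙a : ∀ a b → b ⁻¹ ≈ (a ∙ b) ⁻¹ ∙ a
  b⁻¹≈[a∙b]⁻¹∙a a b = begin
    b ⁻¹                ≈⟨ //-rightDividesˡ a (b ⁻¹) ⟨
    b ⁻¹ ∙ a ⁻¹ ∙ a     ≈⟨ ∙-congʳ (⁻¹-anti-homo-∙ a b) ⟨
    (a ∙ b) ⁻¹ ∙ a      ∎

  module Components {p q : Level} {X : Pred Carrier p} {Y : Pred Carrier q}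
                    (F : Factorization X Y) where

    left right : Carrier → Carrier
    left g = proj₁ (proj₁ F g)
    right g = proj₁ (proj₂ (proj₁ F g))

    left∈X : ∀ g → X (left g)
    left∈X g = proj₁ (proj₂ (proj₂ (proj₁ F g)))

    right∈Y : ∀ g → Y (right g)
    right∈Y g = proj₁ (proj₂ (proj₂ (proj₂ (proj₁ F g))))

    left∙right≈id : ∀ g → left g ∙ right g ≈ g
    left∙right≈id g = proj₂ (proj₂ (proj₂ (proj₂ (proj₁ F g))))

    left-unique : ∀ {g x y} → X x → Y y → x ∙ y ≈ g → left g ≈ x
    left-unique x∈X y∈Y xy≈g =
      proj₁ (proj₂ F (left∈X _) x∈X (right∈Y _) y∈Y (trans (left∙right≈id _) (sym xy≈g)))

    left-cong : ∀ {g g′} → g ≈ g′ → left g ≈ left g′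
    left-cong {g} g≈g′ = sym (left-unique (left∈X g) (right∈Y g) (trans (left∙right≈id g) g≈g′))

  module _ {p q : Level} {X : Pred Carrier p} {Y : Pred Carrier q} where

    factorization-⁻¹ : Respects≈ X → Respects≈ Y → Factorization X Y → Factorization (Y ⁻¹ᵖ) (X ⁻¹ᵖ)
    factorization-⁻¹ respX respY (surj , inj) = surj′ , inj′
      where
      surj′ : ∀ g → ∃[ y ] ∃[ x ] ((Y ⁻¹ᵖ) y × (X ⁻¹ᵖ) x × y ∙ x ≈ g)
      surj′ g with surj (g ⁻¹)
      ... | x , y , x∈X , y∈Y , xy≈g⁻¹ =
        y ⁻¹ , x ⁻¹ , x∈X⇒x⁻¹∈X⁻¹ respY y∈Y , x∈X⇒x⁻¹∈X⁻¹ respX x∈X , (begin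
          y ⁻¹ ∙ x ⁻¹   ≈⟨ ⁻¹-anti-homo-∙ x y ⟨
          (x ∙ y) ⁻¹    ≈⟨ ⁻¹-cong xy≈g⁻¹ ⟩
          g ⁻¹ ⁻¹       ≈⟨ ⁻¹-involutive g ⟩
          g             ∎)
      inj′ : ∀ {y y′ x x′} → (Y ⁻¹ᵖ) y → (Y ⁻¹ᵖ) y′ → (X ⁻¹ᵖ) x → (X ⁻¹ᵖ) x′
           → y ∙ x ≈ y′ ∙ x′ → y ≈ y′ × x ≈ x′
      inj′ {y} {y′} {x} {x′} y∈ y′∈ x∈ x′∈ yx≈y′x′ =
        swap (map ⁻¹-injective ⁻¹-injective (inj x∈ x′∈ y∈ y′∈ inverted))
        where
        inverted : x ⁻¹ ∙ y ⁻¹ ≈ x′ ⁻¹ ∙ y′ ⁻¹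
        inverted = begin
          x ⁻¹ ∙ y ⁻¹     ≈⟨ ⁻¹-anti-homo-∙ y x ⟨
          (y ∙ x) ⁻¹      ≈⟨ ⁻¹-cong yx≈y′x′ ⟩
          (y′ ∙ x′) ⁻¹    ≈⟨ ⁻¹-anti-homo-∙ y′ x′ ⟩
          x′ ⁻¹ ∙ y′ ⁻¹   ∎

  module _ {p q : Level} {A : Pred Carrier p} where

    factorization⇒transversal : {B : Pred Carrier q} → Respects≈ B
      → Factorization A B → Transversal A (B ⁻¹ᵖ)
    factorization⇒transversal {B} respB (surj , inj) g = meets , meets-once
      where
      meets : ∃[ x ] ((g · A) x × (B ⁻¹ᵖ) x)
      meets with surj (g ⁻¹)
      ... | a , b , a∈A , b∈B , ab≈g⁻¹ =
        g ∙ a , (a , a∈A , refl) , respB (sym (a∙b≈g⁻¹⇒[g∙a]⁻¹≈b ab≈g⁻¹)) b∈B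
      meets-once : ∀ {x y} → (g · A) x → (B ⁻¹ᵖ) x → (g · A) y → (B ⁻¹ᵖ) y → x ≈ y
      meets-once {x} {y} (a , a∈A , x≈ga) x⁻¹∈B (a′ , a′∈A , y≈ga′) y⁻¹∈B = begin
        x      ≈⟨ x≈ga ⟩
        g ∙ a  ≈⟨ ∙-congˡ a≈a′ ⟩
        g ∙ a′ ≈⟨ y≈ga′ ⟨
        y      ∎
        where
        a≈a′ : a ≈ a′
        a≈a′ = proj₁ (inj a∈A a′∈A x⁻¹∈B y⁻¹∈B
                 (trans (x≈g∙a⇒a∙x⁻¹≈g⁻¹ x≈ga) (sym (x≈g∙a⇒a∙x⁻¹≈g⁻¹ y≈ga′))))

    transversal⇒factorization : {T : Pred Carrier q} → Respects≈ T
      → Transversal A T → Factorization A (T ⁻¹ᵖ)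
    transversal⇒factorization {T} respT transversal = surj , inj
      where
      surj : ∀ g → ∃[ a ] ∃[ b ] (A a × (T ⁻¹ᵖ) b × a ∙ b ≈ g)
      surj g with proj₁ (transversal (g ⁻¹))
      ... | x , (a , a∈A , x≈g⁻¹a) , x∈T =
        a , x ⁻¹ , a∈A , x∈X⇒x⁻¹∈X⁻¹ respT x∈T ,
        trans (x≈g∙a⇒a∙x⁻¹≈g⁻¹ x≈g⁻¹a) (⁻¹-involutive g)
      inj : ∀ {a a′ b b′} → A a → A a′ → (T ⁻¹ᵖ) b → (T ⁻¹ᵖ) b′
          → a ∙ b ≈ a′ ∙ b′ → a ≈ a′ × b ≈ b′
      inj {a} {a′} {b} {b′} a∈A a′∈A b⁻¹∈T b′⁻¹∈T ab≈a′b′ =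
        ∙-cancelʳ b a a′ (trans ab≈a′b′ (∙-congˡ (sym b≈b′))) , b≈b′
        where
        b≈b′ : b ≈ b′
        b≈b′ = ⁻¹-injective (proj₂ (transversal ((a ∙ b) ⁻¹))
          (a , a∈A , b⁻¹≈[a∙b]⁻¹∙a a b)
          b⁻¹∈T
          (a′ , a′∈A , trans (b⁻¹≈[a∙b]⁻¹∙a a′ b′) (∙-congʳ (⁻¹-cong (sym ab≈a′b′))))
          b′⁻¹∈T)

  module _ {p q : Level} {H : Pred Carrier p} {T : Pred Carrier q} where

    factorization⇒tiling : Factorization H T → Tiling H T
    factorization⇒tiling (surj , inj) = disjoint , covering
      where
      disjoint : ∀ {h h′ x} → H h → H h′ → (h · T) x → (h′ · T) x → h ≈ h′
      disjoint h∈H h′∈H (t , t∈T , x≈ht) (t′ , t′∈T , x≈h′t′) =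
        proj₁ (inj h∈H h′∈H t∈T t′∈T (trans (sym x≈ht) x≈h′t′))
      covering : ∀ g → ∃[ h ] (H h × (h · T) g)
      covering g with surj g
      ... | h , t , h∈H , t∈T , ht≈g = h , h∈H , t , t∈T , sym ht≈g

    tiling⇒factorization : Tiling H T → Factorization H T
    tiling⇒factorization (disjoint , covering) = surj , inj
      where
      surj : ∀ g → ∃[ h ] ∃[ t ] (H h × T t × h ∙ t ≈ g)
      surj g with covering g
      ... | h , h∈H , t , t∈T , g≈ht = h , t , h∈H , t∈T , sym g≈ht
      inj : ∀ {h h′ t t′} → H h → H h′ → T t → T t′ → h ∙ t ≈ h′ ∙ t′ → h ≈ h′ × t ≈ t′
      inj {h} {h′} {t} {t′} h∈H h′∈H t∈T t′∈T ht≈h′t′ =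
        h≈h′ , ∙-cancelˡ h t t′ (trans ht≈h′t′ (∙-congʳ (sym h≈h′)))
        where
        h≈h′ : h ≈ h′
        h≈h′ = disjoint h∈H h′∈H (t , t∈T , refl) (t′ , t′∈T , ht≈h′t′)

  -- Colours are elements of G, up to having the same H-component.
  factorizations⇒kaleidoscopical : {p q r : Level} {A : Pred Carrier p} {B : Pred Carrier q}
    {H : Pred Carrier r} → Respects≈ B
    → Factorization A B → Factorization H (B ⁻¹ᵖ) → Kaleidoscopical A
  factorizations⇒kaleidoscopical {A = A} respB (surj , inj) HB⁻¹ =
    On.setoid setoid left , colour , λ g → colour-injective g , colour-surjective g
    where
    open Components HB⁻¹
    colour : Func setoid (On.setoid setoid left)
    colour = record { to = id ; cong = left-cong }
    colour-injective : ∀ g {x y} → (g · A) x → (g · A) y → left x ≈ left y → x ≈ y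
    colour-injective g {x} {y} (a , a∈A , x≈ga) (a′ , a′∈A , y≈ga′) lx≈ly = begin
      x      ≈⟨ x≈ga ⟩
      g ∙ a  ≈⟨ ∙-congˡ a≈a′ ⟩
      g ∙ a′ ≈⟨ y≈ga′ ⟨
      y      ∎
      where
      a∙right⁻¹≈g⁻¹∙left : ∀ {z a} → z ≈ g ∙ a → a ∙ right z ⁻¹ ≈ g ⁻¹ ∙ left z
      a∙right⁻¹≈g⁻¹∙left {z} z≈ga =
        g∙a≈h∙t⇒a∙t⁻¹≈g⁻¹∙h (trans (sym z≈ga) (sym (left∙right≈id z)))
      a≈a′ : a ≈ a′
      a≈a′ = proj₁ (inj a∈A a′∈A (right∈Y x) (right∈Y y) (begin
        a ∙ right x ⁻¹   ≈⟨ a∙right⁻¹≈g⁻¹∙left x≈ga ⟩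
        g ⁻¹ ∙ left x    ≈⟨ ∙-congˡ lx≈ly ⟩
        g ⁻¹ ∙ left y    ≈⟨ a∙right⁻¹≈g⁻¹∙left y≈ga′ ⟨
        a′ ∙ right y ⁻¹  ∎))
    colour-surjective : ∀ g k → ∃[ x ] ((g · A) x × left x ≈ left k)
    colour-surjective g k with surj (g ⁻¹ ∙ left k)
    ... | a , b , a∈A , b∈B , ab≈g⁻¹d =
      g ∙ a , (a , a∈A , refl) ,
      left-unique (left∈X k) (x∈X⇒x⁻¹∈X⁻¹ respB b∈B) (sym (a∙b≈g⁻¹∙h⇒g∙a≈h∙b⁻¹ ab≈g⁻¹d))

-- Membership in A is only ever used for witnesses, so A need not respect ≈.
proposition1p4 : {c ℓ p : Level} (G : Group c ℓ) (A : Pred (Group.Carrier G) p)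
    → GroupNotions.Respects≈ G A
    → GroupNotions.DoublyComplemented G A ⇔ GroupNotions.HomogeneousKaleidoscopical G A
proposition1p4 G A _ = mk⇔ doublyComplemented⇒homogeneous homogeneous⇒doublyComplemented
  where
  open GroupNotions G
  open Factorizations G

  doublyComplemented⇒homogeneous : DoublyComplemented A → HomogeneousKaleidoscopical A
  doublyComplemented⇒homogeneous (B , C , respB , respC , AB , BC) =
    factorizations⇒kaleidoscopical respB AB C⁻¹B⁻¹ ,
    B ⁻¹ᵖ , C ⁻¹ᵖ , ⁻¹ᵖ-respects respB , ⁻¹ᵖ-respects respC ,
    factorization⇒transversal respB AB , factorization⇒tiling C⁻¹B⁻¹
    where
    C⁻¹B⁻¹ : Factorization (C ⁻¹ᵖ) (B ⁻¹ᵖ)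
    C⁻¹B⁻¹ = factorization-⁻¹ respB respC BC

  homogeneous⇒doublyComplemented : HomogeneousKaleidoscopical A → DoublyComplemented A
  homogeneous⇒doublyComplemented (_ , T , H , respT , respH , transversal , tiling) =
    T ⁻¹ᵖ , H ⁻¹ᵖ , ⁻¹ᵖ-respects respT , ⁻¹ᵖ-respects respH ,
    transversal⇒factorization respT transversal ,
    factorization-⁻¹ respH respT (tiling⇒factorization tiling)
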